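{- Let $\ell$ be a prime, $q$ a prime power, integers $0\le B\le C\le i\le B+C$, $D\in(\mathbb{Z}/\ell^C\mathbb{Z})^\times$ with $D^2q\equiv1\pmod{\ell^B}$, and $t\in\mathbb{Z}$. The following are equivalent: (1) some lift $c\in\mathbb{Z}/\ell^i\mathbb{Z}$ of $D^{ -1}\in\mathbb{Z}/\ell^C\mathbb{Z}$ satisfies $c^2-tc+q\equiv0\pmod{\ell^i}$; (2) $t\equiv Dq+D^{ -1}\pmod{\ell^i}$. Moreover, if these hold, then every one of the $\ell^{i-C}$ lifts $c$ modulo $\ell^i$ of $D^{ -1}\pmod{\ell^C}$ satisfies $c^2-tc+q\equiv0\pmod{\ell^i}$.
   Context: In (2), $Dq+D^{ -1}\pmod{\ell^i}$ means $\tilde Dq+\tilde D^{ -1}$ for any lift $\tilde D$ of $D$ to $\mathbb{Z}/\ell^i\mathbb{Z}$; this residue class does not depend on the lift because $C\le i\le C+B$ and $D^2q\equiv1\pmod{\ell^B}$. A lift modulo $\ell^i$ of a class $x$ modulo $\ell^C$ is any class modulo $\ell^i$ reducing to $x$. -}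

module Defs where

open import Data.Nat using (ℕ; _^_)
open import Data.Integer using (ℤ; +_; _-_; _*_; _+_)
open import Data.Integer.Divisibility using (_∣_)

_≋_[mod_] : ℤ → ℤ → ℕ → Set
a ≋ b [mod n ] = (+ n) ∣ (a - b)

RootMod : (t : ℤ) (q : ℕ) (c : ℤ) (m : ℕ) → Set
RootMod t q c m = (c * c - t * c + + q) ≋ + 0 [mod m ]

-- Condition (2):  t ≡ D q + D⁻¹ (mod ℓ^i), where D is taken as any lift D̃
-- of D (mod ℓ^C) to ℤ/ℓ^i and D⁻¹ as the inverse E of D̃ modulo ℓ^i.
Cond2 : (ℓ C i q : ℕ) (D t : ℤ) → Set
Cond2 ℓ C i q D t =
  (D̃ E : ℤ) → D̃ ≋ D [mod ℓ ^ C ] → (D̃ * E) ≋ + 1 [mod ℓ ^ i ] →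
  t ≋ (D̃ * + q + E) [mod ℓ ^ i ]

open import Data.Nat.Primality using (Prime)
open import Data.Product using (Σ; _×_)
open import Relation.Binary.PropositionalEquality using (_≡_)
open import Data.Nat using (_≤_)

IsPrimePower : ℕ → Set
IsPrimePower q = Σ ℕ λ p → Σ ℕ λ k → Prime p × (1 ≤ k) × (q ≡ p ^ k)

module Submission where

-- Write P = ℓ^i, X = ℓ^C, Y = ℓ^B.  The exponent conditions B ≤ C ≤ i ≤ B + C
-- are used only through the divisibilities  Y ∣ X,  X ∣ P  and  P ∣ X Y
-- (hence P ∣ X²).
--
-- Two general facts
-- carry the argument: an inverse modulo X is refined by one Newton step
-- a ↦ a (2 - a b) to an inverse modulo any P ∣ X², and an element that is a
-- unit modulo P can be cancelled.  For a lift c of D⁻¹ modulo X the Newton step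
-- turns D into D̃ = D (2 - D c), which is congruent to D modulo X and inverse to
-- c modulo P.
--   (2) ⇒ every lift is a root: apply (2) to D̃ and E = c.
--   a root lift ⇒ (2): for any D̃ ≡ D (mod X) with inverse E (mod P) one has
--   E ≡ c (mod X) and c ≡ q D̃ (mod Y), so (E - c)(c - q D̃) ≡ 0 (mod P); this
--   gives t c ≡ c² + q ≡ (D̃ q + E) c (mod P), and c is cancelled.

module HenselLifting where

  open import Data.Integer using (ℤ; +_; _-_; -_; _+_; _*_)
  import Data.Integer.Properties as ℤP
  open import Data.Integer.Divisibility.Signed
    using (_∣_; divides; ∣-trans; ∣m⇒∣-m; ∣m∣n⇒∣m+n; ∣n⇒∣m*n; *-monoʳ-∣; *-monoˡ-∣)
  open import Data.Integer.Tactic.RingSolver using (solve-∀)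
  open import Level using (0ℓ)
  open import Relation.Binary.Bundles using (Setoid)
  open import Relation.Binary.PropositionalEquality using (_≡_; refl; sym; subst)
  import Relation.Binary.Reasoning.Setoid as SetoidReasoning

  *-∣-* : ∀ {X Y a b} → X ∣ a → Y ∣ b → X * Y ∣ a * b
  *-∣-* {X} {Y} {a} {b} X∣a Y∣b = ∣-trans (*-monoʳ-∣ X Y∣b) (*-monoˡ-∣ b X∣a)

  -- Congruence modulo an integer m: m divides the difference.  It is a record
  -- (rather than an abbreviation) so that its indices can be inferred.
  infix 4 _≈_⟨mod_⟩
  record _≈_⟨mod_⟩ (a b m : ℤ) : Set where
    constructor mod-by
    field divides-difference : m ∣ a - b
  open _≈_⟨mod_⟩ public

  mod-by-≡ : ∀ {m a b d} → a - b ≡ d → m ∣ d → a ≈ b ⟨mod m ⟩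
  mod-by-≡ {m} a-b≡d m∣d = mod-by (subst (m ∣_) (sym a-b≡d) m∣d)

  module _ {m : ℤ} where

    ≈-refl : ∀ {a} → a ≈ a ⟨mod m ⟩
    ≈-refl {a} = mod-by-≡ (ℤP.+-inverseʳ a) (divides (+ 0) refl)

    ≈-sym : ∀ {a b} → a ≈ b ⟨mod m ⟩ → b ≈ a ⟨mod m ⟩
    ≈-sym {a} {b} (mod-by a≈b) = mod-by-≡ (swap a b) (∣m⇒∣-m a≈b)
      where
      swap : ∀ a b → b - a ≡ - (a - b)
      swap = solve-∀

    ≈-trans : ∀ {a b c} → a ≈ b ⟨mod m ⟩ → b ≈ c ⟨mod m ⟩ → a ≈ c ⟨mod m ⟩
    ≈-trans {a} {b} {c} (mod-by a≈b) (mod-by b≈c) = mod-by-≡ (split a b c) (∣m∣n⇒∣m+n a≈b b≈c)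
      where
      split : ∀ a b c → a - c ≡ (a - b) + (b - c)
      split = solve-∀

    -- Compatibility with the ring operations; the fixed operand is explicit,
    -- since integer arithmetic computes and cannot be inferred by unification.
    +-congˡ : ∀ a {b c} → b ≈ c ⟨mod m ⟩ → a + b ≈ a + c ⟨mod m ⟩
    +-congˡ a {b} {c} (mod-by b≈c) = mod-by-≡ (cancel a b c) b≈c
      where
      cancel : ∀ a b c → (a + b) - (a + c) ≡ b - c
      cancel = solve-∀

    +-congʳ : ∀ c {a b} → a ≈ b ⟨mod m ⟩ → a + c ≈ b + c ⟨mod m ⟩
    +-congʳ c {a} {b} (mod-by a≈b) = mod-by-≡ (cancel a b c) a≈b
      where
      cancel : ∀ a b c → (a + c) - (b + c) ≡ a - b
      cancel = solve-∀

    neg-cong : ∀ {a b} → a ≈ b ⟨mod m ⟩ → - a ≈ - b ⟨mod m ⟩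
    neg-cong {a} {b} (mod-by a≈b) = mod-by-≡ (negate a b) (∣m⇒∣-m a≈b)
      where
      negate : ∀ a b → - a - - b ≡ - (a - b)
      negate = solve-∀

    *-congˡ : ∀ a {b c} → b ≈ c ⟨mod m ⟩ → a * b ≈ a * c ⟨mod m ⟩
    *-congˡ a {b} {c} (mod-by b≈c) = mod-by-≡ (factor a b c) (∣n⇒∣m*n a b≈c)
      where
      factor : ∀ a b c → a * b - a * c ≡ a * (b - c)
      factor = solve-∀

    *-congʳ : ∀ c {a b} → a ≈ b ⟨mod m ⟩ → a * c ≈ b * c ⟨mod m ⟩
    *-congʳ c {a} {b} (mod-by a≈b) = mod-by-≡ (factor a b c) (∣n⇒∣m*n c a≈b)
      where
      factor : ∀ a b c → a * c - b * c ≡ c * (a - b)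
      factor = solve-∀

    ∣⇒≈0 : ∀ {a} → m ∣ a → a ≈ + 0 ⟨mod m ⟩
    ∣⇒≈0 {a} = mod-by-≡ (ℤP.+-identityʳ a)

  ≈-weaken : ∀ {n m a b} → n ∣ m → a ≈ b ⟨mod m ⟩ → a ≈ b ⟨mod n ⟩
  ≈-weaken n∣m (mod-by m∣a-b) = mod-by (∣-trans n∣m m∣a-b)

  ≈-setoid : ℤ → Setoid 0ℓ 0ℓ
  ≈-setoid m = record
    { Carrier       = ℤ
    ; _≈_           = _≈_⟨mod m ⟩
    ; isEquivalence = record { refl = ≈-refl ; sym = ≈-sym ; trans = ≈-trans }
    }

  inverse-unique : ∀ {m a a′ b b′} → a ≈ a′ ⟨mod m ⟩ →
    a * b ≈ + 1 ⟨mod m ⟩ → a′ * b′ ≈ + 1 ⟨mod m ⟩ → b ≈ b′ ⟨mod m ⟩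
  inverse-unique {m} {a} {a′} {b} {b′} a≈a′ ab≈1 a′b′≈1 = begin
    b                ≡⟨ ℤP.*-identityˡ b ⟨
    + 1 * b          ≈⟨ *-congʳ b (≈-sym a′b′≈1) ⟩
    (a′ * b′) * b    ≡⟨ rearrange a′ b′ b ⟩
    (a′ * b) * b′    ≈⟨ *-congʳ b′ (*-congʳ b (≈-sym a≈a′)) ⟩
    (a * b) * b′     ≈⟨ *-congʳ b′ ab≈1 ⟩
    + 1 * b′         ≡⟨ ℤP.*-identityˡ b′ ⟩
    b′               ∎
    where
    open SetoidReasoning (≈-setoid m)
    rearrange : ∀ a′ b′ b → (a′ * b′) * b ≡ (a′ * b) * b′
    rearrange = solve-∀

  cancel-unit : ∀ {m} u c {a b} → u * c ≈ + 1 ⟨mod m ⟩ →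
    a * c ≈ b * c ⟨mod m ⟩ → a ≈ b ⟨mod m ⟩
  cancel-unit {m} u c {a} {b} uc≈1 ac≈bc = begin
    a                ≡⟨ ℤP.*-identityʳ a ⟨
    a * + 1          ≈⟨ *-congˡ a (≈-sym uc≈1) ⟩
    a * (u * c)      ≡⟨ rearrange a u c ⟩
    (a * c) * u      ≈⟨ *-congʳ u ac≈bc ⟩
    (b * c) * u      ≡⟨ rearrange b u c ⟨
    b * (u * c)      ≈⟨ *-congˡ b uc≈1 ⟩
    b * + 1          ≡⟨ ℤP.*-identityʳ b ⟩
    b                ∎
    where
    open SetoidReasoning (≈-setoid m)
    rearrange : ∀ a u c → a * (u * c) ≡ (a * c) * u
    rearrange = solve-∀

  -- One Newton step for the inverse of b, starting from an approximation a.
  newton : ℤ → ℤ → ℤ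
  newton a b = a * (+ 2 - a * b)

  newton-≈ : ∀ {X} a b → a * b ≈ + 1 ⟨mod X ⟩ → newton a b ≈ a ⟨mod X ⟩
  newton-≈ {X} a b (mod-by ab≈1) = mod-by-≡ (defect a b) (∣n⇒∣m*n (- a) ab≈1)
    where
    defect : ∀ a b → a * (+ 2 - a * b) - a ≡ - a * (a * b - + 1)
    defect = solve-∀

  -- ... and yields an inverse of b modulo every P dividing X², since the new
  -- defect is minus the square of the old one.
  newton-inverse : ∀ {P X} a b → P ∣ X * X → a * b ≈ + 1 ⟨mod X ⟩ →
    newton a b * b ≈ + 1 ⟨mod P ⟩
  newton-inverse {P} {X} a b P∣X² (mod-by ab≈1) =
    mod-by-≡ (defect a b) (∣m⇒∣-m (∣-trans P∣X² (*-∣-* ab≈1 ab≈1)))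
    where
    defect : ∀ a b → a * (+ 2 - a * b) * b - + 1 ≡ - ((a * b - + 1) * (a * b - + 1))
    defect = solve-∀

  module Lifting (P X Y D Dinv q : ℤ)
    (P∣XY : P ∣ X * Y) (Y∣X : Y ∣ X) (X∣P : X ∣ P)
    (D-inverse : D * Dinv ≈ + 1 ⟨mod X ⟩) (D²q≈1 : D * D * q ≈ + 1 ⟨mod Y ⟩) where

    Root : ℤ → ℤ → Set
    Root t c = c * c - t * c + q ≈ + 0 ⟨mod P ⟩

    Cond : ℤ → Set
    Cond t = (D̃ E : ℤ) → D̃ ≈ D ⟨mod X ⟩ → D̃ * E ≈ + 1 ⟨mod P ⟩ →
             t ≈ D̃ * q + E ⟨mod P ⟩

    P∣X² : P ∣ X * X
    P∣X² = ∣-trans P∣XY (*-monoʳ-∣ X Y∣X)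

    module _ (c : ℤ) (c-lift : c ≈ Dinv ⟨mod X ⟩) where

      D-inverse-c : D * c ≈ + 1 ⟨mod X ⟩
      D-inverse-c = ≈-trans (*-congˡ D c-lift) D-inverse

      D̃₀ : ℤ
      D̃₀ = newton D c

      D̃₀≈D : D̃₀ ≈ D ⟨mod X ⟩
      D̃₀≈D = newton-≈ D c D-inverse-c

      D̃₀-inverse : D̃₀ * c ≈ + 1 ⟨mod P ⟩
      D̃₀-inverse = newton-inverse D c P∣X² D-inverse-c

      -- (2) makes c a root: with D̃₀ c ≡ 1, the quadratic collapses to q (1 - D̃₀ c).
      root-of-cond : ∀ t → Cond t → Root t c
      root-of-cond t cond = begin
        c * c - t * c + q                   ≈⟨ +-congʳ q (+-congˡ (c * c) (neg-cong (*-congʳ c t≈))) ⟩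
        c * c - (D̃₀ * q + c) * c + q         ≡⟨ collapse c D̃₀ q ⟩
        q * (+ 1 - D̃₀ * c)                  ≈⟨ *-congˡ q (+-congˡ (+ 1) (neg-cong D̃₀-inverse)) ⟩
        q * (+ 1 - + 1)                     ≡⟨ ℤP.*-zeroʳ q ⟩
        + 0                                 ∎
        where
        open SetoidReasoning (≈-setoid P)
        t≈ : t ≈ D̃₀ * q + c ⟨mod P ⟩
        t≈ = cond D̃₀ c D̃₀≈D D̃₀-inverse
        collapse : ∀ c D̃ q → c * c - (D̃ * q + c) * c + q ≡ q * (+ 1 - D̃ * c)
        collapse = solve-∀

      -- A root lift forces (2): both t c and (D̃ q + E) c are c² + q modulo P.
      cond-of-root : ∀ t → Root t c → Cond t
      cond-of-root t root D̃ E D̃≈D D̃E≈1 =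
        cancel-unit D̃₀ c D̃₀-inverse (≈-trans tc≈ (≈-sym rhs≈))
        where
        E≈c : E ≈ c ⟨mod X ⟩
        E≈c = inverse-unique D̃≈D (≈-weaken X∣P D̃E≈1) D-inverse-c

        c≈qD̃ : c ≈ q * D̃ ⟨mod Y ⟩
        c≈qD̃ = begin
          c                     ≡⟨ ℤP.*-identityʳ c ⟨
          c * + 1               ≈⟨ *-congˡ c (≈-sym D²q≈1) ⟩
          c * (D * D * q)       ≡⟨ regroup c D q ⟩
          (D * c) * (q * D)     ≈⟨ *-congʳ (q * D) (≈-weaken Y∣X D-inverse-c) ⟩
          + 1 * (q * D)         ≡⟨ ℤP.*-identityˡ (q * D) ⟩
          q * D                 ≈⟨ *-congˡ q (≈-weaken Y∣X (≈-sym D̃≈D)) ⟩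
          q * D̃                 ∎
          where
          open SetoidReasoning (≈-setoid Y)
          regroup : ∀ c D q → c * (D * D * q) ≡ (D * c) * (q * D)
          regroup = solve-∀

        errors≈0 : (E - c) * (c - q * D̃) ≈ + 0 ⟨mod P ⟩
        errors≈0 = ∣⇒≈0 (∣-trans P∣XY (*-∣-* (divides-difference E≈c) (divides-difference c≈qD̃)))

        tc≈ : t * c ≈ c * c + q ⟨mod P ⟩
        tc≈ = begin
          t * c                                       ≡⟨ solve-root t c q ⟩
          (c * c + q) - (c * c - t * c + q)           ≈⟨ +-congˡ (c * c + q) (neg-cong root) ⟩
          (c * c + q) - + 0                           ≡⟨ ℤP.+-identityʳ (c * c + q) ⟩
          c * c + q                                   ∎
          where
          open SetoidReasoning (≈-setoid P)
          solve-root : ∀ t c q → t * c ≡ (c * c + q) - (c * c - t * c + q)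
          solve-root = solve-∀

        rhs≈ : (D̃ * q + E) * c ≈ c * c + q ⟨mod P ⟩
        rhs≈ = begin
          (D̃ * q + E) * c                                   ≡⟨ expand D̃ q E c ⟩
          (E - c) * (c - q * D̃) + c * c + q * (D̃ * E)       ≈⟨ +-congʳ (q * (D̃ * E)) (+-congʳ (c * c) errors≈0) ⟩
          + 0 + c * c + q * (D̃ * E)                         ≈⟨ +-congˡ (+ 0 + c * c) (*-congˡ q D̃E≈1) ⟩
          + 0 + c * c + q * + 1                             ≡⟨ simplify c q ⟩
          c * c + q                                         ∎
          where
          open SetoidReasoning (≈-setoid P)
          expand : ∀ D̃ q E c → (D̃ * q + E) * c ≡ (E - c) * (c - q * D̃) + c * c + q * (D̃ * E)
          expand = solve-∀
          simplify : ∀ c q → + 0 + c * c + q * + 1 ≡ c * c + q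
          simplify = solve-∀

open HenselLifting

open import Defs
open import Data.Nat using (ℕ; _≤_; _+_; _^_)
open import Data.Nat.Primality using (Prime)
open import Data.Integer using (ℤ; +_) renaming (_*_ to _*ℤ_)
open import Data.Product using (Σ; _×_; _,_)
open import Function.Bundles using (_⇔_; mk⇔)
import Data.Nat as ℕ
import Data.Nat.Properties as ℕP
import Data.Nat.Divisibility as ℕD
import Data.Integer.Properties as ℤP
open import Data.Integer.Divisibility.Signed using (_∣_; ∣ᵤ⇒∣; ∣⇒∣ᵤ)
open import Relation.Binary.PropositionalEquality using (sym; trans; subst; cong)
open Relation.Binary.PropositionalEquality.≡-Reasoning

≋⇒≈ : ∀ {a b n} → a ≋ b [mod n ] → a ≈ b ⟨mod + n ⟩
≋⇒≈ a≋b = mod-by (∣ᵤ⇒∣ a≋b)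

≈⇒≋ : ∀ {a b n} → a ≈ b ⟨mod + n ⟩ → a ≋ b [mod n ]
≈⇒≋ a≈b = ∣⇒∣ᵤ (divides-difference a≈b)

^-∣ : ∀ l {m n} → m ≤ n → l ^ m ℕD.∣ l ^ n
^-∣ l {m} {n} m≤n = ℕD.divides (l ^ (n ℕ.∸ m)) (begin
  l ^ n                       ≡⟨ cong (l ^_) (sym (ℕP.m+[n∸m]≡n m≤n)) ⟩
  l ^ (m + (n ℕ.∸ m))         ≡⟨ ℕP.^-distribˡ-+-* l m (n ℕ.∸ m) ⟩
  l ^ m ℕ.* l ^ (n ℕ.∸ m)     ≡⟨ ℕP.*-comm (l ^ m) _ ⟩
  l ^ (n ℕ.∸ m) ℕ.* l ^ m     ∎)

^-∣-product : ∀ l B C {i} → i ≤ B + C → + (l ^ i) ∣ + (l ^ C) *ℤ + (l ^ B)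
^-∣-product l B C {i} i≤B+C = subst (+ (l ^ i) ∣_) (ℤP.pos-* (l ^ C) (l ^ B))
  (∣ᵤ⇒∣ (ℕD.∣-trans (^-∣ l i≤B+C)
    (ℕD.∣-reflexive (trans (cong (l ^_) (ℕP.+-comm B C)) (ℕP.^-distribˡ-+-* l C B)))))

lemma6 : (ℓ q B C i : ℕ) → Prime ℓ → IsPrimePower q →
    B ≤ C → C ≤ i → i ≤ B + C →
    (D Dinv : ℤ) → (D *ℤ Dinv) ≋ + 1 [mod ℓ ^ C ] →
    (D *ℤ D *ℤ + q) ≋ + 1 [mod ℓ ^ B ] →
    (t : ℤ) →
    ((Σ ℤ λ c → c ≋ Dinv [mod ℓ ^ C ] × RootMod t q c (ℓ ^ i)) ⇔ Cond2 ℓ C i q D t)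
    × (Cond2 ℓ C i q D t → (c : ℤ) → c ≋ Dinv [mod ℓ ^ C ] → RootMod t q c (ℓ ^ i))
lemma6 ℓ q B C i _ _ B≤C C≤i i≤B+C D Dinv D-inverse D²q≈1 t =
  mk⇔ (λ (c , c-lift , root) → fromCond (cond-of-root c (≋⇒≈ c-lift) t (≋⇒≈ root)))
      (λ cond → Dinv , Dinv-lift , every-lift cond Dinv Dinv-lift)
  , every-lift
  where
  open Lifting (+ (ℓ ^ i)) (+ (ℓ ^ C)) (+ (ℓ ^ B)) D Dinv (+ q) (^-∣-product ℓ B C i≤B+C)
    (∣ᵤ⇒∣ (^-∣ ℓ B≤C)) (∣ᵤ⇒∣ (^-∣ ℓ C≤i)) (≋⇒≈ D-inverse) (≋⇒≈ D²q≈1)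

  toCond : Cond2 ℓ C i q D t → Cond t
  toCond cond D̃ E D̃≈D D̃E≈1 = ≋⇒≈ (cond D̃ E (≈⇒≋ D̃≈D) (≈⇒≋ D̃E≈1))

  fromCond : Cond t → Cond2 ℓ C i q D t
  fromCond cond D̃ E D̃≈D D̃E≈1 = ≈⇒≋ (cond D̃ E (≋⇒≈ D̃≈D) (≋⇒≈ D̃E≈1))

  every-lift : Cond2 ℓ C i q D t → (c : ℤ) → c ≋ Dinv [mod ℓ ^ C ] → RootMod t q c (ℓ ^ i)
  every-lift cond c c-lift = ≈⇒≋ (root-of-cond c (≋⇒≈ c-lift) t (toCond cond))

  Dinv-lift : Dinv ≋ Dinv [mod ℓ ^ C ]
  Dinv-lift = ≈⇒≋ (≈-refl {a = Dinv})
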